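{- Let $T$ be a finitary monad on $\mathbf{Set}$, $\mathcal{D}$ a category with small products and $V\colon\mathcal{D}\to\mathbf{Set}$ a faithful functor preserving small limits. Let $(A,\hat\alpha\colon TA\to A)$ be a $T$-algebra and $A_{\mathcal{D}}\in\mathcal{D}$ with $VA_{\mathcal{D}}=A$. Then there exists a $\mathcal{D}$-relative $T$-algebra $\bar A$ with $U_{\mathcal{D}}\bar A=A_{\mathcal{D}}$ and $\bar V(\bar A)=(A,\hat\alpha)$ if and only if for every natural number $n$ (viewed as the set $\{0,\dots,n-1\}$) and every $t\in Tn$, the function $\alpha_n(t)\colon A^n\to A$, $h\mapsto\hat\alpha((Th)(t))$, is $Vk$ for some $\mathcal{D}$-morphism $k\colon A_{\mathcal{D}}^n\to A_{\mathcal{D}}$ (under the canonical identification $V(A_{\mathcal{D}}^n)\cong A^n$).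
   Context: A monad is finitary if it preserves filtered colimits. For $B\in\mathcal{D}$ and a set $X$, $B^X$ is the $X$-fold product with projections $\pi_x$; for $g\colon X\to Y$, $g^*\colon B^Y\to B^X$ satisfies $\pi_x\circ g^*=\pi_{g(x)}$. The monad $\mathcal{D}(B^{(-)},B)$ on $\mathbf{Set}$: on $g$ it sends $k$ to $k\circ g^*$; unit $\eta_X(x)=\pi_x$; multiplication $\mu_X(\Xi)=\Xi\circ\langle\varphi\rangle_{\varphi\in\mathcal{D}(B^X,B)}$. A $\mathcal{D}$-relative $T$-algebra is a pair $(B,\beta)$ with $\beta\colon T\to\mathcal{D}(B^{(-)},B)$ a monad map; $U_{\mathcal{D}}(B,\beta)=B$. $\bar V$ sends $(B,\beta)$ to the $T$-algebra on $VB$ with structure $t\mapsto V(\beta_{VB}(t))(\mathrm{id}_{VB})$, using $V(B^{VB})\cong(VB)^{VB}$. -}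

module Defs where

open import Level using (Level; _⊔_) renaming (suc to lsuc; zero to lzero)
open import Data.Nat using (ℕ)
open import Data.Fin using (Fin)
open import Data.Product using (Σ; _×_; _,_; ∃)
open import Relation.Binary.PropositionalEquality using (_≡_)

-- Conventions.  "Set" (the category) is Agda's universe Set (= Set₀),
-- morphisms are functions, compared pointwise (extensionally).
-- Categories are locally small (hom-types in Set) and morphism equality
-- is propositional equality _≡_.

record Monad : Set₁ where
  field
    T       : Set → Set
    map     : {X Y : Set} → (X → Y) → T X → T Y
    map-cong : {X Y : Set} {f g : X → Y} → (∀ x → f x ≡ g x) → ∀ t → map f t ≡ map g t
    map-id  : {X : Set} (t : T X) → map (λ x → x) t ≡ t
    map-∘   : {X Y Z : Set} (g : Y → Z) (f : X → Y) (t : T X) →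
              map (λ x → g (f x)) t ≡ map g (map f t)
    η       : {X : Set} → X → T X
    μ       : {X : Set} → T (T X) → T X
    η-nat   : {X Y : Set} (f : X → Y) (x : X) → map f (η x) ≡ η (f x)
    μ-nat   : {X Y : Set} (f : X → Y) (t : T (T X)) → map f (μ t) ≡ μ (map (map f) t)
    μ-η     : {X : Set} (t : T X) → μ (η t) ≡ t
    μ-Tη    : {X : Set} (t : T X) → μ (map η t) ≡ t
    μ-assoc : {X : Set} (t : T (T (T X))) → μ (μ t) ≡ μ (map μ t)

record IsAlgebra (M : Monad) (A : Set) (α : Monad.T M A → A) : Set where
  open Monad M
  field
    alg-η : (a : A) → α (η a) ≡ a
    alg-μ : (t : T (T A)) → α (μ t) ≡ α (map α t)

record SmallCategory : Set₁ where
  field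
    Ob   : Set
    Hom  : Ob → Ob → Set
    id   : {j : Ob} → Hom j j
    _∘_  : {i j k : Ob} → Hom j k → Hom i j → Hom i k
    idˡ  : {i j : Ob} (f : Hom i j) → id ∘ f ≡ f
    idʳ  : {i j : Ob} (f : Hom i j) → f ∘ id ≡ f
    assoc : {i j k l : Ob} (h : Hom k l) (g : Hom j k) (f : Hom i j) →
            (h ∘ g) ∘ f ≡ h ∘ (g ∘ f)

record IsFiltered (J : SmallCategory) : Set where
  open SmallCategory J
  field
    inhabited : Ob
    cospan    : (j k : Ob) → Σ Ob λ l → Hom j l × Hom k l
    coequalise : {j k : Ob} (f g : Hom j k) →
                 Σ Ob λ l → Σ (Hom k l) λ h → h ∘ f ≡ h ∘ g

record SetDiagram (J : SmallCategory) : Set₁ where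
  open SmallCategory J
  field
    F₀ : Ob → Set
    F₁ : {j k : Ob} → Hom j k → F₀ j → F₀ k
    F-id : {j : Ob} (x : F₀ j) → F₁ id x ≡ x
    F-∘  : {i j k : Ob} (g : Hom j k) (f : Hom i j) (x : F₀ i) →
           F₁ (g ∘ f) x ≡ F₁ g (F₁ f x)

IsColimitSet : (J : SmallCategory) (O : SmallCategory.Ob J → Set)
  (M : {j k : SmallCategory.Ob J} → SmallCategory.Hom J j k → O j → O k)
  (L : Set) (ι : (j : SmallCategory.Ob J) → O j → L) → Set₁
IsColimitSet J O M L ι =
  ((j k : Ob) (f : Hom j k) (x : O j) → ι k (M f x) ≡ ι j x) ×
  ((C : Set) (c : (j : Ob) → O j → C) →
   ((j k : Ob) (f : Hom j k) (x : O j) → c k (M f x) ≡ c j x) →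
   Σ (L → C) λ m →
     ((j : Ob) (x : O j) → m (ι j x) ≡ c j x) ×
     ((m' : L → C) → ((j : Ob) (x : O j) → m' (ι j x) ≡ c j x) →
       (y : L) → m' y ≡ m y))
  where open SmallCategory J

IsLimitSet : (J : SmallCategory) (O : SmallCategory.Ob J → Set)
  (M : {j k : SmallCategory.Ob J} → SmallCategory.Hom J j k → O j → O k)
  (L : Set) (ν : (j : SmallCategory.Ob J) → L → O j) → Set₁
IsLimitSet J O M L ν =
  ((j k : Ob) (f : Hom j k) (y : L) → M f (ν j y) ≡ ν k y) ×
  ((C : Set) (c : (j : Ob) → C → O j) →
   ((j k : Ob) (f : Hom j k) (x : C) → M f (c j x) ≡ c k x) →
   Σ (C → L) λ m →
     ((j : Ob) (x : C) → ν j (m x) ≡ c j x) ×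
     ((m' : C → L) → ((j : Ob) (x : C) → ν j (m' x) ≡ c j x) →
       (x : C) → m' x ≡ m x))
  where open SmallCategory J

IsFinitary : Monad → Set₁
IsFinitary M =
  (J : SmallCategory) → IsFiltered J → (D : SetDiagram J) →
  (L : Set) (ι : (j : SmallCategory.Ob J) → SetDiagram.F₀ D j → L) →
  IsColimitSet J (SetDiagram.F₀ D) (SetDiagram.F₁ D) L ι →
  IsColimitSet J (λ j → T (SetDiagram.F₀ D j)) (λ f → map (SetDiagram.F₁ D f))
               (T L) (λ j → map (ι j))
  where open Monad M

record Category (o : Level) : Set (lsuc o) where
  infixr 9 _∘_
  field
    Obj  : Set o
    Hom  : Obj → Obj → Set
    id   : {A : Obj} → Hom A A
    _∘_  : {A B C : Obj} → Hom B C → Hom A B → Hom A C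
    idˡ  : {A B : Obj} (f : Hom A B) → id ∘ f ≡ f
    idʳ  : {A B : Obj} (f : Hom A B) → f ∘ id ≡ f
    assoc : {A B C D : Obj} (h : Hom C D) (g : Hom B C) (f : Hom A B) →
            (h ∘ g) ∘ f ≡ h ∘ (g ∘ f)

record Products {o : Level} (C : Category o) : Set (lsuc lzero ⊔ o) where
  open Category C
  field
    Π     : {I : Set} → (I → Obj) → Obj
    π     : {I : Set} {F : I → Obj} (i : I) → Hom (Π F) (F i)
    ⟨_⟩   : {I : Set} {F : I → Obj} {X : Obj} → ((i : I) → Hom X (F i)) → Hom X (Π F)
    π-⟨⟩  : {I : Set} {F : I → Obj} {X : Obj} (f : (i : I) → Hom X (F i)) (i : I) →
            π i ∘ ⟨ f ⟩ ≡ f i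
    ⟨⟩-unique : {I : Set} {F : I → Obj} {X : Obj} (f : (i : I) → Hom X (F i))
            (h : Hom X (Π F)) → ((i : I) → π i ∘ h ≡ f i) → h ≡ ⟨ f ⟩

  _^_ : Obj → Set → Obj
  B ^ X = Π {X} (λ _ → B)

  _* : {B : Obj} {X Y : Set} → (X → Y) → Hom (B ^ Y) (B ^ X)
  _* {B} {X} {Y} g = ⟨_⟩ {X} {λ _ → B} (λ x → π {Y} {λ _ → B} (g x))

record Diagram {o : Level} (J : SmallCategory) (C : Category o) : Set o where
  module J = SmallCategory J
  open Category C
  field
    F₀ : J.Ob → Obj
    F₁ : {j k : J.Ob} → J.Hom j k → Hom (F₀ j) (F₀ k)
    F-id : {j : J.Ob} → F₁ (J.id {j}) ≡ id
    F-∘  : {i j k : J.Ob} (g : J.Hom j k) (f : J.Hom i j) → F₁ (g J.∘ f) ≡ F₁ g ∘ F₁ f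

IsLimit : {o : Level} (C : Category o) (J : SmallCategory) (D : Diagram J C)
  (L : Category.Obj C) (ν : (j : SmallCategory.Ob J) → Category.Hom C L (Diagram.F₀ D j)) →
  Set o
IsLimit C J D L ν =
  ((j k : J.Ob) (f : J.Hom j k) → F₁ f ∘ ν j ≡ ν k) ×
  ((X : Obj) (c : (j : J.Ob) → Hom X (F₀ j)) →
   ((j k : J.Ob) (f : J.Hom j k) → F₁ f ∘ c j ≡ c k) →
   Σ (Hom X L) λ m →
     ((j : J.Ob) → ν j ∘ m ≡ c j) ×
     ((m' : Hom X L) → ((j : J.Ob) → ν j ∘ m' ≡ c j) → m' ≡ m))
  where
    module J = SmallCategory J
    open Category C
    open Diagram D using (F₀; F₁)

record SetFunctor {o : Level} (C : Category o) : Set (lsuc lzero ⊔ o) where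
  open Category C
  field
    V₀ : Obj → Set
    V₁ : {A B : Obj} → Hom A B → V₀ A → V₀ B
    V-id : {A : Obj} (x : V₀ A) → V₁ (id {A}) x ≡ x
    V-∘  : {A B D : Obj} (g : Hom B D) (f : Hom A B) (x : V₀ A) →
           V₁ (g ∘ f) x ≡ V₁ g (V₁ f x)

IsFaithful : {o : Level} {C : Category o} → SetFunctor C → Set o
IsFaithful {C = C} V =
  {A B : Obj} (f g : Hom A B) → ((x : V₀ A) → V₁ f x ≡ V₁ g x) → f ≡ g
  where open Category C
        open SetFunctor V

PreservesLimits : {o : Level} {C : Category o} → SetFunctor C → Set (lsuc lzero ⊔ o)
PreservesLimits {C = C} V =
  (J : SmallCategory) (D : Diagram J C) (L : Obj)
  (ν : (j : SmallCategory.Ob J) → Hom L (Diagram.F₀ D j)) →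
  IsLimit C J D L ν →
  IsLimitSet J (λ j → V₀ (Diagram.F₀ D j)) (λ f → V₁ (Diagram.F₁ D f))
             (V₀ L) (λ j → V₁ (ν j))
  where open Category C
        open SetFunctor V

module _ {o : Level} {C : Category o} (P : Products C) (M : Monad) where
  open Category C
  open Products P
  open Monad M

  -- β : T → D(B^(-), B) is a monad morphism
  record IsRelativeAlgebra (B : Obj) (β : (X : Set) → T X → Hom (B ^ X) B) : Set₁ where
    field
      β-nat  : {X Y : Set} (g : X → Y) (t : T X) → β Y (map g t) ≡ β X t ∘ (g *)
      β-η    : {X : Set} (x : X) → β X (η x) ≡ π {X} {λ _ → B} x
      -- multiplication: β_X (μ τ) = μ^D_X (D(B^{β_X},B) (β_{TX} τ))
      --                         = (β_{TX} τ ∘ (β_X)*) ∘ ⟨ φ ⟩_{φ ∈ D(B^X,B)}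
      β-μ    : {X : Set} (τ : T (T X)) →
               β X (μ τ) ≡ (β (T X) τ ∘ ((β X) *)) ∘
                           ⟨_⟩ {Hom (B ^ X) B} {λ _ → B} (λ φ → φ)

  record RelativeAlgebra : Set (lsuc lzero ⊔ o) where
    field
      carrier : Obj
      β       : (X : Set) → T X → Hom (carrier ^ X) carrier
      isRel   : IsRelativeAlgebra carrier β

  U : RelativeAlgebra → Obj
  U = RelativeAlgebra.carrier

  module _ (V : SetFunctor C) where
    open SetFunctor V

    canon : {B : Obj} {X : Set} → V₀ (B ^ X) → X → V₀ B
    canon {B} {X} p x = V₁ (π {X} {λ _ → B} x) p

    -- The structure map of V̄(B, β): t ↦ V(β_{VB} t)(id_{VB}), where id_{VB}
    -- is regarded as an element p of V(B^{VB}) via canon (canon p = id).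
    -- "V̄ Ā has structure map α̂" :
    VbarIs : (A : RelativeAlgebra) → (T (V₀ (U A)) → V₀ (U A)) → Set
    VbarIs A α̂ =
      (t : T (V₀ (U A))) (p : V₀ (U A ^ V₀ (U A))) →
      ((x : V₀ (U A)) → canon p x ≡ x) →
      V₁ (RelativeAlgebra.β A (V₀ (U A)) t) p ≡ α̂ t

    VbarOf : (B : Obj) (β : (X : Set) → T X → Hom (B ^ X) B) →
             IsRelativeAlgebra B β → (T (V₀ B) → V₀ B) → Set
    VbarOf B β r α̂ = VbarIs (record { carrier = B ; β = β ; isRel = r }) α̂

-- Say φ : A𝒟^X → A𝒟 lifts t ∈ T X when Vφ is the derived operation
-- h ↦ α̂ (T h t) under V(A𝒟^X) ≅ A^X.  Since V is faithful, lifts are unique,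
-- so a family β of lifts of all derived operations satisfies the laws of a
-- monad morphism because α̂ satisfies those of an algebra, and its V̄ is α̂.
-- Conversely, V preserves the power A𝒟^A, so every point of V(A𝒟^X) is
-- V(h*) of the point corresponding to id_A; naturality of β together with
-- V̄ = α̂ then forces every β_X(t) to be a lift of t.  Finally, T X is the
-- filtered colimit of the T n over the comma category Fin ↓ X because T is
-- finitary; reindexing the given lifts of finitary operations along the
-- families n → X yields, by uniqueness, a cocone, which glues to lifts on T X.
module Submission where

open import Defs
open import Level using (Level)
open import Data.Nat using (ℕ; zero; suc; _+_)
open import Data.Fin using (Fin; zero; suc; _↑ˡ_; _↑ʳ_; splitAt; _≟_)
open import Data.Fin.Properties using (splitAt-↑ˡ; splitAt-↑ʳ)
open import Data.Vec using (Vec; lookup; tabulate)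
open import Data.Vec.Properties using (lookup∘tabulate; tabulate∘lookup; tabulate-cong)
open import Data.Sum using ([_,_]′)
open import Data.Product using (Σ; _×_; _,_; proj₁; proj₂)
open import Data.Unit using (⊤; tt)
open import Data.Empty using (⊥-elim)
open import Function using (_∘′_)
open import Function.Bundles using (_⇔_; mk⇔)
open import Relation.Nullary using (yes; no)
open import Relation.Binary.PropositionalEquality
open import Axiom.UniquenessOfIdentityProofs.WithK using (uip)

module FinOver (X : Set) where

  Family : Set
  Family = Σ ℕ λ n → Fin n → X

  -- A morphism is stored as a vector rather than a function so that
  -- morphism equality needs no function extensionality.
  record _⇒_ (j k : Family) : Set where
    constructor mk⇒
    field
      table   : Vec (Fin (proj₁ k)) (proj₁ j)
      commute : tabulate (proj₂ k ∘′ lookup table) ≡ tabulate (proj₂ j)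
  open _⇒_

  apply : {j k : Family} → j ⇒ k → Fin (proj₁ j) → Fin (proj₁ k)
  apply h = lookup (table h)

  apply-commutes : {j k : Family} (h : j ⇒ k) (i : Fin (proj₁ j)) →
                   proj₂ k (apply h i) ≡ proj₂ j i
  apply-commutes {n , f} {m , g} (mk⇒ u e) i = begin
    g (lookup u i)                        ≡⟨ lookup∘tabulate (g ∘′ lookup u) i ⟨
    lookup (tabulate (g ∘′ lookup u)) i   ≡⟨ cong (λ v → lookup v i) e ⟩
    lookup (tabulate f) i                 ≡⟨ lookup∘tabulate f i ⟩
    f i                                   ∎
    where open ≡-Reasoning

  fromFunction : {n m : ℕ} {f : Fin n → X} {g : Fin m → X} (u : Fin n → Fin m) →
                 (∀ i → g (u i) ≡ f i) → (n , f) ⇒ (m , g)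
  fromFunction {g = g} u e =
    mk⇒ (tabulate u) (tabulate-cong λ i → trans (cong g (lookup∘tabulate u i)) (e i))

  ⇒-ext : {j k : Family} {h h′ : j ⇒ k} → table h ≡ table h′ → h ≡ h′
  ⇒-ext {h = mk⇒ u e} {mk⇒ .u e′} refl = cong (mk⇒ u) (uip e e′)

  id⇒ : {j : Family} → j ⇒ j
  id⇒ = fromFunction (λ i → i) (λ _ → refl)

  _∘⇒_ : {i j k : Family} → j ⇒ k → i ⇒ j → i ⇒ k
  g ∘⇒ h = fromFunction (apply g ∘′ apply h)
    (λ x → trans (apply-commutes g (apply h x)) (apply-commutes h x))

  category : SmallCategory
  category = record
    { Ob = Family ; Hom = _⇒_ ; id = id⇒ ; _∘_ = _∘⇒_
    ; idˡ = λ h → ⇒-ext (trans (tabulate-cong λ x → lookup∘tabulate _ (apply h x))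
                                (tabulate∘lookup (table h)))
    ; idʳ = λ h → ⇒-ext (trans (tabulate-cong λ x → cong (apply h) (lookup∘tabulate _ x))
                                (tabulate∘lookup (table h)))
    ; assoc = λ h g f → ⇒-ext (tabulate-cong λ x →
        trans (lookup∘tabulate _ (apply f x)) (cong (apply h) (sym (lookup∘tabulate _ x))))
    }

  diagram : SetDiagram category
  diagram = record
    { F₀ = λ j → Fin (proj₁ j)
    ; F₁ = apply
    ; F-id = lookup∘tabulate _
    ; F-∘ = λ _ _ → lookup∘tabulate _
    }

  redirect : {m : ℕ} → Fin m → Fin m → Fin m → Fin m
  redirect b a x with x ≟ b
  ... | yes _ = a
  ... | no _  = x

  redirect-source : {m : ℕ} (b a : Fin m) → redirect b a b ≡ a
  redirect-source b a with b ≟ b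
  ... | yes _ = refl
  ... | no b≢b = ⊥-elim (b≢b refl)

  redirect-target : {m : ℕ} (b a : Fin m) → redirect b a a ≡ a
  redirect-target b a with a ≟ b
  ... | yes _ = refl
  ... | no _  = refl

  redirect-preserves : {m : ℕ} (g : Fin m → X) {a b : Fin m} → g a ≡ g b →
                       ∀ x → g (redirect b a x) ≡ g x
  redirect-preserves g {a} {b} gab x with x ≟ b
  ... | yes refl = gab
  ... | no _     = refl

  coequalise : {n m : ℕ} (g : Fin m → X) (u v : Fin n → Fin m) → (∀ i → g (u i) ≡ g (v i)) →
    Σ (Fin m → Fin m) λ w → (∀ x → g (w x) ≡ g x) × (∀ i → w (u i) ≡ w (v i))
  coequalise {zero} g u v e = (λ x → x) , (λ _ → refl) , λ ()
  coequalise {suc n} g u v e =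
    let w , w-pres , w-coeq = coequalise g (r ∘′ u ∘′ suc) (r ∘′ v ∘′ suc)
          (λ i → trans (r-pres (u (suc i))) (trans (e (suc i)) (sym (r-pres (v (suc i))))))
    in w ∘′ r , (λ x → trans (w-pres (r x)) (r-pres x)) ,
       λ { zero    → cong w (trans (redirect-target (v zero) (u zero))
                                   (sym (redirect-source (v zero) (u zero))))
         ; (suc i) → w-coeq i }
    where
      r = redirect (v zero) (u zero)
      r-pres = redirect-preserves g (e zero)

  isFiltered : IsFiltered category
  isFiltered = record
    { inhabited = 0 , λ ()
    ; cospan = cospan
    ; coequalise = coequalise⇒
    }
    where
      cospan : (j k : Family) → Σ Family λ l → j ⇒ l × k ⇒ l
      cospan (n , f) (m , g) =
        (n + m , [ f , g ]′ ∘′ splitAt n) ,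
        fromFunction (_↑ˡ m) (λ i → cong [ f , g ]′ (splitAt-↑ˡ n i m)) ,
        fromFunction (n ↑ʳ_) (λ i → cong [ f , g ]′ (splitAt-↑ʳ n m i))

      coequalise⇒ : {j k : Family} (h₁ h₂ : j ⇒ k) →
                    Σ Family λ l → Σ (k ⇒ l) λ h → h ∘⇒ h₁ ≡ h ∘⇒ h₂
      coequalise⇒ {k = m , g} h₁ h₂
        with coequalise g (apply h₁) (apply h₂)
               (λ i → trans (apply-commutes h₁ i) (sym (apply-commutes h₂ i)))
      ... | w , w-pres , w-coeq =
        (m , g) , fromFunction w w-pres ,
        ⇒-ext (tabulate-cong λ i → trans (lookup∘tabulate w _)
                 (trans (w-coeq i) (sym (lookup∘tabulate w _))))

  isColimit : IsColimitSet category (SetDiagram.F₀ diagram) apply X proj₂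
  isColimit = (λ _ _ → apply-commutes) , λ C c c-cocone →
      (λ x → c (1 , λ _ → x) zero)
    , (λ { (n , f) i → sym (c-cocone (1 , λ _ → f i) (n , f)
                                       (fromFunction (λ _ → i) (λ _ → refl)) zero) })
    , λ m′ m′-factors x → m′-factors (1 , λ _ → x) zero

colimit-jointlyEpic : {J : SmallCategory} {O : SmallCategory.Ob J → Set}
  {F : {j k : SmallCategory.Ob J} → SmallCategory.Hom J j k → O j → O k}
  {L : Set} {ι : (j : SmallCategory.Ob J) → O j → L} → IsColimitSet J O F L ι →
  {C : Set} (m m′ : L → C) → (∀ j x → m (ι j x) ≡ m′ (ι j x)) → ∀ y → m y ≡ m′ y
colimit-jointlyEpic {ι = ι} (ι-cocone , universal) m m′ agree y =
  trans (unique m agree y) (sym (unique m′ (λ _ _ → refl) y))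
  where
    unique = proj₂ (proj₂ (universal _ (λ j x → m′ (ι j x))
                                       (λ j k f x → cong m′ (ι-cocone j k f x))))

limit-jointlyMonic : {J : SmallCategory} {O : SmallCategory.Ob J → Set}
  {F : {j k : SmallCategory.Ob J} → SmallCategory.Hom J j k → O j → O k}
  {L : Set} {ν : (j : SmallCategory.Ob J) → L → O j} → IsLimitSet J O F L ν →
  (x x′ : L) → (∀ j → ν j x ≡ ν j x′) → x ≡ x′
limit-jointlyMonic {ν = ν} (ν-cone , universal) x x′ agree =
  trans (unique (λ _ → x) (λ j _ → agree j) tt) (sym (unique (λ _ → x′) (λ _ _ → refl) tt))
  where
    unique = proj₂ (proj₂ (universal ⊤ (λ j _ → ν j x′) (λ j k f _ → ν-cone j k f x′)))

discrete : Set → SmallCategory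
discrete I = record
  { Ob = I ; Hom = _≡_ ; id = refl ; _∘_ = λ g f → trans f g
  ; idˡ = λ { refl → refl } ; idʳ = λ _ → refl
  ; assoc = λ { refl refl refl → refl } }

module Powers {o : Level} {C : Category o} (P : Products C) (M : Monad) (V : SetFunctor C) where
  open Category C
  open Products P
  open SetFunctor V

  components : {B : Obj} {I : Set} → V₀ (B ^ I) → I → V₀ B
  components = canon P M V

  components-⟨⟩ : {I : Set} {B X : Obj} (f : I → Hom X B) (p : V₀ X) (i : I) →
                  components (V₁ (⟨_⟩ {I} {λ _ → B} f) p) i ≡ V₁ (f i) p
  components-⟨⟩ f p i = trans (sym (V-∘ _ _ p)) (cong (λ h → V₁ h p) (π-⟨⟩ f i))

  components-* : {B : Obj} {X Y : Set} (g : X → Y) (p : V₀ (B ^ Y)) (x : X) →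
                 components (V₁ (_* {B} g) p) x ≡ components p (g x)
  components-* g p = components-⟨⟩ _ p

  constant : (I : Set) → Obj → Diagram (discrete I) C
  constant I B = record
    { F₀ = λ _ → B ; F₁ = λ _ → id ; F-id = refl ; F-∘ = λ _ _ → sym (idˡ id) }

  power-isLimit : (I : Set) (B : Obj) →
                  IsLimit C (discrete I) (constant I B) (B ^ I) (π {I} {λ _ → B})
  power-isLimit I B = (λ { i .i refl → idˡ _ }) ,
    λ X c _ → ⟨ c ⟩ , π-⟨⟩ c , λ m′ m′-factors → ⟨⟩-unique c m′ m′-factors

  module _ (preserves : PreservesLimits V) {I : Set} {B : Obj} where

    private
      preserved : IsLimitSet (discrete I) (λ _ → V₀ B) (λ _ → V₁ id)
                             (V₀ (B ^ I)) (λ i → V₁ (π i))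
      preserved = preserves (discrete I) (constant I B) (B ^ I) (π {I} {λ _ → B})
                            (power-isLimit I B)

    components-injective : (p p′ : V₀ (B ^ I)) →
                           (∀ i → components p i ≡ components p′ i) → p ≡ p′
    components-injective = limit-jointlyMonic {J = discrete I} {F = λ _ → V₁ id} preserved

    components-surjective : (h : I → V₀ B) → Σ (V₀ (B ^ I)) λ p → ∀ i → components p i ≡ h i
    components-surjective h =
      let m , m-factors , _ = proj₂ preserved ⊤ (λ i _ → h i) (λ { i .i refl _ → V-id _ })
      in m tt , λ i → m-factors i tt

module Lifting {o : Level} (M : Monad) {C : Category o} (P : Products C) (V : SetFunctor C)
  (A : Category.Obj C) (α̂ : Monad.T M (SetFunctor.V₀ V A) → SetFunctor.V₀ V A) where
  open Monad M
  open Category C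
  open Products P
  open SetFunctor V
  open Powers P M V

  Lifts : (X : Set) → T X → Hom (A ^ X) A → Set
  Lifts X t φ = (p : V₀ (A ^ X)) → V₁ φ p ≡ α̂ (map (components p) t)

  Lifting : Set₁
  Lifting = Σ ((X : Set) → T X → Hom (A ^ X) A) λ β → ∀ X t → Lifts X t (β X t)

  Lifts-unique : IsFaithful V → {X : Set} {t : T X} {φ ψ : Hom (A ^ X) A} →
                 Lifts X t φ → Lifts X t ψ → φ ≡ ψ
  Lifts-unique faithful φ-lifts ψ-lifts =
    faithful _ _ λ p → trans (φ-lifts p) (sym (ψ-lifts p))

  Lifts-reindex : {X Y : Set} {s : T Y} {φ : Hom (A ^ Y) A} → Lifts Y s φ →
                  (g : Y → X) → Lifts X (map g s) (φ ∘ _* {A} g)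
  Lifts-reindex {s = s} {φ} φ-lifts g p = begin
    V₁ (φ ∘ g *) p                          ≡⟨ V-∘ φ (g *) p ⟩
    V₁ φ (V₁ (g *) p)                       ≡⟨ φ-lifts _ ⟩
    α̂ (map (components (V₁ (g *) p)) s)     ≡⟨ cong α̂ (map-cong (components-* g p) s) ⟩
    α̂ (map (components p ∘′ g) s)           ≡⟨ cong α̂ (map-∘ (components p) g s) ⟩
    α̂ (map (components p) (map g s))        ∎
    where open ≡-Reasoning

  module _ (algebra : IsAlgebra M (V₀ A) α̂) where
    open IsAlgebra algebra

    π-Lifts-η : {X : Set} (x : X) → Lifts X (η x) (π {X} {λ _ → A} x)
    π-Lifts-η x p = sym (trans (cong α̂ (η-nat (components p) x)) (alg-η (components p x)))

    Lifts-μ : ((β , lifts) : Lifting) {X : Set} (τ : T (T X)) →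
              Lifts X (μ τ) ((β (T X) τ ∘ _* {A} (β X)) ∘
                             ⟨_⟩ {Hom (A ^ X) A} {λ _ → A} (λ φ → φ))
    Lifts-μ (β , lifts) {X} τ p = begin
      V₁ ((β (T X) τ ∘ β X *) ∘ ⟨ (λ φ → φ) ⟩) p   ≡⟨ V-∘ _ _ p ⟩
      V₁ (β (T X) τ ∘ β X *) q                    ≡⟨ Lifts-reindex (lifts (T X) τ) (β X) q ⟩
      α̂ (map (components q) (map (β X) τ))        ≡⟨ cong α̂ (map-∘ _ _ τ) ⟨
      α̂ (map (components q ∘′ β X) τ)             ≡⟨ cong α̂ (map-cong operation τ) ⟩
      α̂ (map (α̂ ∘′ map (components p)) τ)         ≡⟨ cong α̂ (map-∘ α̂ (map (components p)) τ) ⟩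
      α̂ (map α̂ (map (map (components p)) τ))      ≡⟨ alg-μ _ ⟨
      α̂ (μ (map (map (components p)) τ))          ≡⟨ cong α̂ (μ-nat (components p) τ) ⟨
      α̂ (map (components p) (μ τ))                ∎
      where
        open ≡-Reasoning
        q = V₁ (⟨_⟩ {Hom (A ^ X) A} {λ _ → A} (λ φ → φ)) p
        operation : (t : T X) → components q (β X t) ≡ α̂ (map (components p) t)
        operation t = trans (components-⟨⟩ _ p (β X t)) (lifts X t p)

    lifting⇒isRelativeAlgebra : IsFaithful V → ((β , _) : Lifting) → IsRelativeAlgebra P M A β
    lifting⇒isRelativeAlgebra faithful (β , lifts) = record
      { β-nat = λ {X} {Y} g t → Lifts-unique faithful (lifts Y (map g t)) (Lifts-reindex (lifts X t) g)
      ; β-η   = λ {X} x → Lifts-unique faithful (lifts X (η x)) (π-Lifts-η x)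
      ; β-μ   = λ {X} τ → Lifts-unique faithful (lifts X (μ τ)) (Lifts-μ (β , lifts) τ)
      }

  lifting⇒Vbar : ((β , lifts) : Lifting) (r : IsRelativeAlgebra P M A β) → VbarOf P M V A β r α̂
  lifting⇒Vbar (β , lifts) r t p p-id =
    trans (lifts _ t p) (cong α̂ (trans (map-cong p-id t) (map-id t)))

  lifting⇒relativeAlgebra : IsAlgebra M (V₀ A) α̂ → IsFaithful V → Lifting →
    Σ ((X : Set) → T X → Hom (A ^ X) A) λ β →
      Σ (IsRelativeAlgebra P M A β) λ r → VbarOf P M V A β r α̂
  lifting⇒relativeAlgebra algebra faithful lifting =
    proj₁ lifting , isRelative , lifting⇒Vbar lifting isRelative
    where isRelative = lifting⇒isRelativeAlgebra algebra faithful lifting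

  relativeAlgebra⇒lifting : PreservesLimits V → (β : (X : Set) → T X → Hom (A ^ X) A)
    (r : IsRelativeAlgebra P M A β) → VbarOf P M V A β r α̂ → ∀ X t → Lifts X t (β X t)
  relativeAlgebra⇒lifting preserves β r vbar X t p = begin
    V₁ (β X t) p                     ≡⟨ cong (V₁ (β X t)) p≡h*generic ⟩
    V₁ (β X t) (V₁ (h *) generic)    ≡⟨ V-∘ _ _ generic ⟨
    V₁ (β X t ∘ h *) generic         ≡⟨ cong (λ φ → V₁ φ generic) (β-nat h t) ⟨
    V₁ (β (V₀ A) (map h t)) generic  ≡⟨ vbar (map h t) generic generic-id ⟩
    α̂ (map h t)                      ∎
    where
      open ≡-Reasoning
      open IsRelativeAlgebra r
      h = components p
      generic-point = components-surjective preserves (λ (a : V₀ A) → a)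
      generic = proj₁ generic-point
      generic-id = proj₂ generic-point
      p≡h*generic = components-injective preserves p (V₁ (h *) generic)
        λ x → sym (trans (components-* h generic x) (generic-id (h x)))

  module _ (finitary : IsFinitary M) (faithful : IsFaithful V)
    (finite : (n : ℕ) (t : T (Fin n)) → Σ (Hom (A ^ Fin n) A) (Lifts (Fin n) t)) where

    private module Extension (X : Set) where
      open FinOver X

      T-colimit : IsColimitSet category (λ j → T (Fin (proj₁ j))) (λ h → map (apply h))
                               (T X) (λ j → map (proj₂ j))
      T-colimit = finitary category isFiltered diagram X proj₂ isColimit

      reindexed : (j : Family) → T (Fin (proj₁ j)) → Hom (A ^ X) A
      reindexed (n , f) s = proj₁ (finite n s) ∘ f *

      reindexed-lifts : (j : Family) (s : T (Fin (proj₁ j))) →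
                        Lifts X (map (proj₂ j) s) (reindexed j s)
      reindexed-lifts (n , f) s = Lifts-reindex (proj₂ (finite n s)) f

      reindexed-cocone : (j k : Family) (h : j ⇒ k) (s : T (Fin (proj₁ j))) →
                         reindexed k (map (apply h) s) ≡ reindexed j s
      reindexed-cocone j k h s = Lifts-unique faithful
        (subst (λ y → Lifts X y (reindexed k (map (apply h) s))) (proj₁ T-colimit j k h s)
               (reindexed-lifts k _))
        (reindexed-lifts j s)

      extension : T X → Hom (A ^ X) A
      extension = proj₁ (proj₂ T-colimit _ reindexed reindexed-cocone)

      extension-factors : (j : Family) (s : T (Fin (proj₁ j))) →
                          extension (map (proj₂ j) s) ≡ reindexed j s
      extension-factors = proj₁ (proj₂ (proj₂ T-colimit _ reindexed reindexed-cocone))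

      extension-lifts : (t : T X) → Lifts X t (extension t)
      extension-lifts t p =
        colimit-jointlyEpic {J = category} T-colimit
          (λ y → V₁ (extension y) p) (λ y → α̂ (map (components p) y))
          (λ j s → trans (cong (λ φ → V₁ φ p) (extension-factors j s)) (reindexed-lifts j s p)) t

    finitary-lifting : Lifting
    finitary-lifting = Extension.extension , Extension.extension-lifts

proposition4p13 : {o : Level} (M : Monad) → IsFinitary M →
    (C : Category o) (P : Products C) (V : SetFunctor C) →
    IsFaithful V → PreservesLimits V →
    (A𝒟 : Category.Obj C)
    (α̂ : Monad.T M (SetFunctor.V₀ V A𝒟) → SetFunctor.V₀ V A𝒟) →
    IsAlgebra M (SetFunctor.V₀ V A𝒟) α̂ →
    (Σ ((X : Set) → Monad.T M X → Category.Hom C (Products._^_ P A𝒟 X) A𝒟) λ β →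
       Σ (IsRelativeAlgebra P M A𝒟 β) λ r →
         VbarOf P M V A𝒟 β r α̂)
    ⇔
    ((n : ℕ) (t : Monad.T M (Fin n)) →
       Σ (Category.Hom C (Products._^_ P A𝒟 (Fin n)) A𝒟) λ k →
         (p : SetFunctor.V₀ V (Products._^_ P A𝒟 (Fin n))) →
         SetFunctor.V₁ V k p ≡ α̂ (Monad.map M (canon P M V p) t))
proposition4p13 M finitary C P V faithful preserves A α̂ algebra = mk⇔
  (λ (β , r , vbar) n t → β (Fin n) t , relativeAlgebra⇒lifting preserves β r vbar (Fin n) t)
  (λ finite → lifting⇒relativeAlgebra algebra faithful (finitary-lifting finitary faithful finite))
  where open Lifting M P V A α̂
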